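{- Let $d\geq 2$ be an integer and $n$ a positive integer. Then $\gcd(H_d(n)-1,\,n)$ equals: (a) $n$, if $d$ is a composite number different from $4$, or if $d=4$ and $\nu_2(n)\neq2$; (b) $n/2$, if $d=4$ and $\nu_2(n)=2$; (c) $n/d^{\nu_d(n)}$, if $d$ is a prime number.
   Context: $\nu_q(n)$ denotes the exponent of the prime $q$ in $n$. For an integer $d\geq2$ and $n\ge0$, $H_d(n)$ is the number of permutations in $S_n$ that are products of pairwise disjoint $d$-cycles (identity included); equivalently $H_d(n)=\sum_{k=0}^{\lfloor n/d\rfloor}\frac{n!}{(n-dk)!\,k!\,d^k}$. -}

module Defs where

open import Data.Nat using (ℕ; zero; suc; _+_; _*_; _∸_; _^_; _!; NonZero)
open import Data.Nat.Properties using (_!≢0; m*n≢0; m^n≢0)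
open import Data.Nat.DivMod using (_/_)
open import Data.Nat.Divisibility using (_∣?_)
open import Data.List using (List; map; upTo)
open import Data.Nat.ListAction using (sum)
open import Relation.Nullary using (yes; no)

Hterm : (d : ℕ) → .{{NonZero d}} → ℕ → ℕ → ℕ
Hterm d n k =
  _/_ (n !) (((n ∸ d * k) ! * k !) * d ^ k)
    {{m*n≢0 ((n ∸ d * k) ! * k !) (d ^ k) {{m*n≢0 _ _ {{(n ∸ d * k) !≢0}} {{k !≢0}}}} {{m^n≢0 d k}}}}

-- H_d(n) = sum_{k=0}^{⌊n/d⌋} n! / ((n - d k)! k! d^k)
-- (upTo m = [0, 1, …, m-1], so we sum over k < ⌊n/d⌋ + 1).
H : (d : ℕ) → .{{NonZero d}} → ℕ → ℕ
H d n = sum (map (Hterm d n) (upTo (suc (n / d))))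

νAux : ℕ → (q : ℕ) → .{{NonZero q}} → ℕ → ℕ
νAux zero    q n = zero
νAux (suc f) q n with q ∣? n
... | yes _ = suc (νAux f q (n / q))
... | no  _ = zero

-- ν q n : exponent of q in n (for q ≥ 2 and n ≥ 1; fuel n suffices since q^e ≤ n).
ν : (q : ℕ) → .{{NonZero q}} → ℕ → ℕ
ν q n = νAux n q n

{-# OPTIONS --safe #-}

-- Write Tₖ = n! / ((n - d k)! k! dᵏ), so that H_d(n) - 1 = ∑_{1 ≤ k ≤ n/d} Tₖ and
--   dᵏ Tₖ = n · C(n - 1, d k - 1) · C(d k - 1, k) · (d k - 1 - k)!.
-- Hence every divisor of n coprime to d divides H_d(n) - 1, and n itself divides Tₖ
-- whenever dᵏ ∣ (d k - 1 - k)!.  For composite d ≠ 4 this holds for every k, because d ∣ (d - 2)!.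
-- For a prime p and n = pᵛ r with p ∤ r, the part r divides H_p(n) - 1 while p does not:
-- when n = p m, Wilson's theorem gives Tₖ ≡ C(m, k) (p - 1)ᵏ (mod p), so H_p(n) ≡ pᵐ ≡ 0.
-- For d = 4, n divides Tₖ for k ≥ 3, and 32 (T₁ + T₂) = n · f(n - 1) with f(m) = m(m - 1)(m - 2)(8 + (m - 3)⋯(m - 6));
-- for even n, f(n - 1) is divisible by 32 unless ν₂(n) = 2, when it is 16 times an odd number.
module Submission where

open import Data.Bool.Base using (Bool; true; false; if_then_else_; T)
open import Data.Bool.Properties using (T-≡)
open import Data.Fin.Base using (toℕ)
open import Data.List.Base using (map; applyUpTo)
open import Data.Nat.Base
open import Data.Nat.Combinatorics using (_C_; nCk+nC[k+1]≡[n+1]C[k+1]; k![n∸k]!∣n!)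
open import Data.Nat.Coprimality using (Coprime; coprime-divisor; coprime-Bézout; prime⇒coprime; coprime⇒gcd≡1)
open import Data.Nat.Divisibility
open import Data.Nat.DivMod
open import Data.Nat.GCD using (module Bézout; gcd; gcd[m,n]∣m; gcd[m,n]∣n; gcd-greatest; c*gcd[m,n]≡gcd[cm,cn])
open import Data.Nat.ListAction using (sum)
open import Data.Nat.Primality
  using (Prime; Composite; composite; composite⇒nonTrivial; prime⇒nonTrivial; prime⇒irreducible; euclidsLemma; prime[2])
open import Data.Nat.Properties
open import Data.Nat.Tactic.RingSolver using (solve-∀)
open import Data.Product using (_×_; _,_; ∃-syntax; proj₁; proj₂; map₂)
open import Data.Sum using (inj₁; inj₂)
open import Function.Base using (_∘_)
open import Function.Bundles using (Equivalence)
open import Relation.Binary.Definitions using (Tri; tri<; tri≈; tri>)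
open import Relation.Binary.PropositionalEquality
open import Relation.Nullary using (yes; no; ¬_; contradiction)
open import Algebra.Properties.CommutativeSemigroup *-commutativeSemigroup using (x∙yz≈y∙xz)
import Algebra.Definitions.RawSemiring +-*-rawSemiring as Semiring
import Algebra.Properties.CommutativeSemiring.Binomial +-*-commutativeSemiring as Binomial
import Data.Vec.Functional as Vector

open import Defs

open ≡-Reasoning

∑< : ℕ → (ℕ → ℕ) → ℕ
∑< zero    f = 0
∑< (suc N) f = f 0 + ∑< N (f ∘ suc)

syntax ∑< N (λ k → e) = ∑[ k < N ] e

∑-cong : ∀ N {f g : ℕ → ℕ} → (∀ {k} → k < N → f k ≡ g k) → ∑< N f ≡ ∑< N g
∑-cong zero    eq = refl
∑-cong (suc N) eq = cong₂ _+_ (eq z<s) (∑-cong N (eq ∘ s<s))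

∣-∑ : ∀ N {c} {f : ℕ → ℕ} → (∀ {k} → k < N → c ∣ f k) → c ∣ ∑< N f
∣-∑ zero    c∣f = _ ∣0
∣-∑ (suc N) c∣f = ∣m∣n⇒∣m+n (c∣f z<s) (∣-∑ N (c∣f ∘ s<s))

∑-%-cong : ∀ N {p} .{{_ : NonZero p}} {f g : ℕ → ℕ} →
           (∀ {k} → k < N → f k % p ≡ g k % p) → ∑< N f % p ≡ ∑< N g % p
∑-%-cong zero    eq = refl
∑-%-cong (suc N) {p} {f} {g} eq = begin
  (f 0 + ∑< N (f ∘ suc)) % p                  ≡⟨ %-distribˡ-+ (f 0) _ p ⟩
  (f 0 % p + ∑< N (f ∘ suc) % p) % p          ≡⟨ cong₂ (λ a b → (a + b) % p) (eq z<s) (∑-%-cong N (eq ∘ s<s)) ⟩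
  (g 0 % p + ∑< N (g ∘ suc) % p) % p          ≡⟨ %-distribˡ-+ (g 0) _ p ⟨
  (g 0 + ∑< N (g ∘ suc)) % p                  ∎

sum-map-applyUpTo : ∀ N (f g : ℕ → ℕ) → sum (map f (applyUpTo g N)) ≡ ∑< N (f ∘ g)
sum-map-applyUpTo zero    f g = refl
sum-map-applyUpTo (suc N) f g = cong (f (g 0) +_) (sum-map-applyUpTo N f (g ∘ suc))

binomial-theorem : ∀ x m → ∑[ k < suc m ] ((m C k) * x ^ k) ≡ (x + 1) ^ m
binomial-theorem x m = begin
  ∑[ k < suc m ] ((m C k) * x ^ k)      ≡⟨ ∑-cong (suc m) (λ {k} _ → sym (term≡ k)) ⟩
  ∑< (suc m) term                       ≡⟨ foldr-toℕ (suc m) term ⟨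
  Binomial.binomialExpansion x 1 m      ≡⟨ Binomial.theorem m x 1 ⟨
  (x + 1) Semiring.^ m                  ≡⟨ ^≗^ (x + 1) m ⟩
  (x + 1) ^ m                           ∎
  where
  term : ℕ → ℕ
  term k = (m C k) Semiring.× (x Semiring.^ k * 1 Semiring.^ (m ∸ k))
  foldr-toℕ : ∀ N (g : ℕ → ℕ) → Vector.foldr _+_ 0 {N} (g ∘ toℕ) ≡ ∑< N g
  foldr-toℕ zero    g = refl
  foldr-toℕ (suc N) g = cong (g 0 +_) (foldr-toℕ N (g ∘ suc))
  ×≗* : ∀ c y → c Semiring.× y ≡ c * y
  ×≗* zero    y = refl
  ×≗* (suc c) y = cong (y +_) (×≗* c y)
  ^≗^ : ∀ y k → y Semiring.^ k ≡ y ^ k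
  ^≗^ y zero    = refl
  ^≗^ y (suc k) = cong (y *_) (^≗^ y k)
  term≡ : ∀ k → term k ≡ (m C k) * x ^ k
  term≡ k = begin
    term k                                              ≡⟨ ×≗* (m C k) _ ⟩
    (m C k) * (x Semiring.^ k * 1 Semiring.^ (m ∸ k))   ≡⟨ cong₂ (λ a b → (m C k) * (a * b)) (^≗^ x k) (trans (^≗^ 1 (m ∸ k)) (^-zeroˡ (m ∸ k))) ⟩
    (m C k) * (x ^ k * 1)                               ≡⟨ cong ((m C k) *_) (*-identityʳ (x ^ k)) ⟩
    (m C k) * x ^ k                                     ∎

infixl 8 _↓_

_↓_ : ℕ → ℕ → ℕ
a ↓ zero  = 1
a ↓ suc b = a * (a ∸ 1) ↓ b

!≡↓*! : ∀ {a b} → b ≤ a → a ! ≡ a ↓ b * (a ∸ b) !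
!≡↓*! {a}     {zero}  _         = sym (+-identityʳ (a !))
!≡↓*! {suc a} {suc b} (s≤s b≤a) = begin
  suc a * a !                ≡⟨ cong (suc a *_) (!≡↓*! b≤a) ⟩
  suc a * (a ↓ b * (a ∸ b) !) ≡⟨ *-assoc (suc a) (a ↓ b) _ ⟨
  suc a * a ↓ b * (a ∸ b) !   ∎

n<k⇒n↓k≡0 : ∀ {n k} → n < k → n ↓ k ≡ 0
n<k⇒n↓k≡0 {zero}  {suc k} _         = refl
n<k⇒n↓k≡0 {suc n} {suc k} (s≤s n<k) = trans (cong (suc n *_) (n<k⇒n↓k≡0 n<k)) (*-zeroʳ (suc n))

↓-+ : ∀ a b c → a ↓ (b + c) ≡ a ↓ b * (a ∸ b) ↓ c
↓-+ a zero    c = sym (+-identityʳ (a ↓ c))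
↓-+ a (suc b) c = begin
  a * (a ∸ 1) ↓ (b + c)                    ≡⟨ cong (a *_) (↓-+ (a ∸ 1) b c) ⟩
  a * ((a ∸ 1) ↓ b * (a ∸ 1 ∸ b) ↓ c)      ≡⟨ cong (λ x → a * ((a ∸ 1) ↓ b * x ↓ c)) (∸-+-assoc a 1 b) ⟩
  a * ((a ∸ 1) ↓ b * (a ∸ suc b) ↓ c)      ≡⟨ *-assoc a _ _ ⟨
  a * (a ∸ 1) ↓ b * (a ∸ suc b) ↓ c        ∎

↓-suc : ∀ a b → a ↓ suc b ≡ a ↓ b * (a ∸ b)
↓-suc a b = begin
  a ↓ suc b               ≡⟨ cong (a ↓_) (+-comm 1 b) ⟩
  a ↓ (b + 1)             ≡⟨ ↓-+ a b 1 ⟩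
  a ↓ b * ((a ∸ b) * 1)   ≡⟨ cong (a ↓ b *_) (*-identityʳ (a ∸ b)) ⟩
  a ↓ b * (a ∸ b)         ∎

suc-*-↓ : ∀ a b → suc a * a ↓ b ≡ suc b * a ↓ b + a ↓ suc b
suc-*-↓ a b with b ≤? a
... | yes b≤a = begin
  suc a * a ↓ b                      ≡⟨ cong (_* a ↓ b) (m+[n∸m]≡n (m≤n⇒m≤1+n b≤a)) ⟨
  (b + (suc a ∸ b)) * a ↓ b          ≡⟨ cong (λ x → (b + x) * a ↓ b) (+-∸-assoc 1 b≤a) ⟩
  (b + suc (a ∸ b)) * a ↓ b          ≡⟨ regroup b (a ∸ b) (a ↓ b) ⟩
  suc b * a ↓ b + a ↓ b * (a ∸ b)    ≡⟨ cong (suc b * a ↓ b +_) (↓-suc a b) ⟨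
  suc b * a ↓ b + a ↓ suc b          ∎
  where
  regroup : ∀ x y z → (x + suc y) * z ≡ suc x * z + z * y
  regroup = solve-∀
... | no b≰a = begin
  suc a * a ↓ b                      ≡⟨ cong (suc a *_) a↓b≡0 ⟩
  suc a * 0                          ≡⟨ *-zeroʳ (suc a) ⟩
  0                                  ≡⟨ cong₂ _+_ (trans (cong (suc b *_) a↓b≡0) (*-zeroʳ (suc b))) (n<k⇒n↓k≡0 (m<n⇒m<1+n a<b)) ⟨
  suc b * a ↓ b + a ↓ suc b          ∎
  where
  a<b = ≰⇒> b≰a
  a↓b≡0 = n<k⇒n↓k≡0 a<b

↓≡C*! : ∀ a b → a ↓ b ≡ (a C b) * b !
↓≡C*! a       zero    = refl
↓≡C*! zero    (suc b) = refl
↓≡C*! (suc a) (suc b) = begin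
  suc a * a ↓ b                                  ≡⟨ suc-*-↓ a b ⟩
  suc b * a ↓ b + a ↓ suc b                      ≡⟨ cong₂ (λ x y → suc b * x + y) (↓≡C*! a b) (↓≡C*! a (suc b)) ⟩
  suc b * ((a C b) * b !) + (a C suc b) * suc b !     ≡⟨ distrib (suc b) (a C b) (b !) (a C suc b) ⟩
  (a C b + a C suc b) * suc b !                  ≡⟨ cong (_* suc b !) (nCk+nC[k+1]≡[n+1]C[k+1] a b) ⟩
  (suc a C suc b) * suc b !                        ∎
  where
  distrib : ∀ x y z w → x * (y * z) + w * (x * z) ≡ (y + w) * (x * z)
  distrib = solve-∀

-- (d k)! / (k! dᵏ), the number of permutations of d k points that are products of k disjoint d-cycles
cycleCount : ℕ → ℕ → ℕ
cycleCount d zero    = 1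
cycleCount d (suc k) = (d * k + (d ∸ 1)) ↓ (d ∸ 1) * cycleCount d k

[d*k]!≡k!*d^k*cycleCount : ∀ d k .{{_ : NonZero d}} → (d * k) ! ≡ k ! * d ^ k * cycleCount d k
[d*k]!≡k!*d^k*cycleCount d@(suc e) zero    = cong _! (*-zeroʳ d)
[d*k]!≡k!*d^k*cycleCount d@(suc e) (suc k) = begin
  (d * suc k) !                                         ≡⟨ cong _! (trans (*-suc d k) (+-comm d (d * k))) ⟩
  (d * k + d) !                                         ≡⟨ !≡↓*! (m≤n+m d (d * k)) ⟩
  (d * k + d) ↓ d * (d * k + d ∸ d) !                   ≡⟨ cong₂ (λ x y → (d * k + d) * x ↓ e * y !) (+-∸-assoc (d * k) (s≤s z≤n)) (m+n∸n≡m (d * k) d) ⟩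
  (d * k + d) * (d * k + e) ↓ e * (d * k) !             ≡⟨ cong ((d * k + d) * (d * k + e) ↓ e *_) ([d*k]!≡k!*d^k*cycleCount d k) ⟩
  (d * k + d) * (d * k + e) ↓ e * (k ! * d ^ k * c)     ≡⟨ regroup e k ((d * k + e) ↓ e) (k !) (d ^ k) c ⟩
  suc k * k ! * (d * d ^ k) * ((d * k + e) ↓ e * c)     ∎
  where
  c = cycleCount d k
  regroup : ∀ e k x f q c → (suc e * k + suc e) * x * (f * q * c) ≡ suc k * f * (suc e * q) * (x * c)
  regroup = solve-∀

Hterm≡C*cycleCount : ∀ d n k .{{_ : NonZero d}} → d * k ≤ n → Hterm d n k ≡ (n C (d * k)) * cycleCount d k
Hterm≡C*cycleCount d n k dk≤n = begin
  (n ! / X) {{nz}}                 ≡⟨ /-congˡ {{nz}} n!≡ ⟩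
  (B * M * X / X) {{nz}}           ≡⟨ m*n/n≡m (B * M) X {{nz}} ⟩
  B * M                            ∎
  where
  B = n C (d * k)
  M = cycleCount d k
  X = ((n ∸ d * k) ! * k !) * d ^ k
  nz : NonZero X
  nz = m*n≢0 _ (d ^ k) {{m*n≢0 _ _ {{(n ∸ d * k) !≢0}} {{k !≢0}}}} {{m^n≢0 d k}}
  regroup : ∀ c m a b f → c * (a * b * m) * f ≡ c * m * ((f * a) * b)
  regroup = solve-∀
  n!≡ : n ! ≡ B * M * X
  n!≡ = begin
    n !                                      ≡⟨ !≡↓*! dk≤n ⟩
    n ↓ (d * k) * (n ∸ d * k) !              ≡⟨ cong (_* (n ∸ d * k) !) (↓≡C*! n (d * k)) ⟩
    B * (d * k) ! * (n ∸ d * k) !            ≡⟨ cong (λ x → B * x * (n ∸ d * k) !) ([d*k]!≡k!*d^k*cycleCount d k) ⟩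
    B * (k ! * d ^ k * M) * (n ∸ d * k) !    ≡⟨ regroup B M (k !) (d ^ k) ((n ∸ d * k) !) ⟩
    B * M * X                                ∎

Hterm-zero : ∀ d n .{{_ : NonZero d}} → Hterm d n 0 ≡ 1
Hterm-zero d n = begin
  Hterm d n 0                      ≡⟨ Hterm≡C*cycleCount d n 0 (subst (_≤ n) (sym (*-zeroʳ d)) z≤n) ⟩
  (n C (d * 0)) * 1                ≡⟨ cong (λ x → (n C x) * 1) (*-zeroʳ d) ⟩
  1                                ∎

k!*d^k*Hterm≡↓ : ∀ d n k .{{_ : NonZero d}} → d * k ≤ n → k ! * d ^ k * Hterm d n k ≡ n ↓ (d * k)
k!*d^k*Hterm≡↓ d n k dk≤n = begin
  k ! * d ^ k * Hterm d n k        ≡⟨ cong (k ! * d ^ k *_) (Hterm≡C*cycleCount d n k dk≤n) ⟩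
  k ! * d ^ k * (B * M)            ≡⟨ regroup (k !) (d ^ k) B M ⟩
  B * (k ! * d ^ k * M)            ≡⟨ cong (B *_) ([d*k]!≡k!*d^k*cycleCount d k) ⟨
  B * (d * k) !                    ≡⟨ ↓≡C*! n (d * k) ⟨
  n ↓ (d * k)                      ∎
  where
  B = n C (d * k)
  M = cycleCount d k
  regroup : ∀ a b c m → a * b * (c * m) ≡ c * (a * b * m)
  regroup = solve-∀

d^k*Hterm≡n*C*C*! : ∀ d n k .{{_ : NonZero d}} .{{_ : NonZero k}} → 2 ≤ d → d * k ≤ n →
  d ^ k * Hterm d n k ≡ n * (((n ∸ 1) C (d * k ∸ 1)) * ((d * k ∸ 1) C k)) * (d * k ∸ 1 ∸ k) !
d^k*Hterm≡n*C*C*! d@(suc (suc f)) n@(suc n-1) k@(suc j) (s≤s (s≤s z≤n)) dk≤n =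
  *-cancelˡ-≡ _ _ (k !) {{k !≢0}} (begin
    k ! * (d ^ k * t)                                       ≡⟨ *-assoc (k !) (d ^ k) t ⟨
    k ! * d ^ k * t                                         ≡⟨ k!*d^k*Hterm≡↓ d n k dk≤n ⟩
    n * n-1 ↓ s                                             ≡⟨ cong (n *_) (↓≡C*! n-1 s) ⟩
    n * ((n-1 C s) * s !)                                   ≡⟨ cong (λ x → n * ((n-1 C s) * x)) (!≡↓*! k≤s) ⟩
    n * ((n-1 C s) * (s ↓ k * (s ∸ k) !))                   ≡⟨ cong (λ x → n * ((n-1 C s) * (x * (s ∸ k) !))) (↓≡C*! s k) ⟩
    n * ((n-1 C s) * ((s C k) * k ! * (s ∸ k) !))           ≡⟨ regroup n (n-1 C s) (s C k) (k !) ((s ∸ k) !) ⟩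
    k ! * (n * ((n-1 C s) * (s C k)) * (s ∸ k) !)           ∎)
  where
  t = Hterm d n k
  s = j + suc f * k
  k≤s : k ≤ s
  k≤s = ≤-trans (m≤m+n k (f * k)) (m≤n+m (suc f * k) j)
  regroup : ∀ a b c x r → a * (b * (c * x * r)) ≡ x * (a * (b * c) * r)
  regroup = solve-∀
d^k*Hterm≡n*C*C*! (suc (suc f)) zero (suc j) _ ()

coprime-* : ∀ {c a b} → Coprime c a → Coprime c b → Coprime c (a * b)
coprime-* {c} {a} ca cb (i∣c , i∣ab) = cb (i∣c , coprime-divisor ia i∣ab)
  where
  ia : Coprime _ a
  ia (j∣i , j∣a) = ca (∣-trans j∣i i∣c , j∣a)

coprime-^ : ∀ {c a} k → Coprime c a → Coprime c (a ^ k)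
coprime-^ zero    _  (_ , i∣1) = ∣1⇒≡1 i∣1
coprime-^ (suc k) ca = coprime-* ca (coprime-^ k ca)

∣Hterm-of-coprime : ∀ d n k {c} .{{_ : NonZero d}} .{{_ : NonZero k}} → 2 ≤ d → d * k ≤ n →
  c ∣ n → Coprime c d → c ∣ Hterm d n k
∣Hterm-of-coprime d n k {c} 2≤d dk≤n c∣n c⊥d = coprime-divisor (coprime-^ k c⊥d)
  (subst (c ∣_) (sym (d^k*Hterm≡n*C*C*! d n k 2≤d dk≤n)) (∣m⇒∣m*n _ (∣m⇒∣m*n _ c∣n)))

n∣Hterm-of-∣! : ∀ d n k .{{_ : NonZero d}} .{{_ : NonZero k}} → 2 ≤ d → d * k ≤ n →
  d ^ k ∣ (d * k ∸ 1 ∸ k) ! → n ∣ Hterm d n k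
n∣Hterm-of-∣! d n k 2≤d dk≤n d^k∣r! = *-cancelˡ-∣ (d ^ k) {{m^n≢0 d k}}
  (subst₂ _∣_ (*-comm n (d ^ k)) (sym (d^k*Hterm≡n*C*C*! d n k 2≤d dk≤n)) (*-pres-∣ (m∣m*n {n} B) d^k∣r!))
  where
  B = ((n ∸ 1) C (d * k ∸ 1)) * ((d * k ∸ 1) C k)

H≡∑ : ∀ d n .{{_ : NonZero d}} → H d n ≡ ∑[ k < suc (n / d) ] Hterm d n k
H≡∑ d n = sum-map-applyUpTo (suc (n / d)) (Hterm d n) (λ k → k)

H≡1+∑ : ∀ d n .{{_ : NonZero d}} → H d n ≡ 1 + ∑[ j < n / d ] Hterm d n (suc j)
H≡1+∑ d n = trans (H≡∑ d n) (cong (_+ ∑[ j < n / d ] Hterm d n (suc j)) (Hterm-zero d n))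

H∸1≡∑ : ∀ d n .{{_ : NonZero d}} → H d n ∸ 1 ≡ ∑[ j < n / d ] Hterm d n (suc j)
H∸1≡∑ d n = cong (_∸ 1) (H≡1+∑ d n)

<n/d⇒d*[1+j]≤n : ∀ d n {j} .{{_ : NonZero d}} → j < n / d → d * suc j ≤ n
<n/d⇒d*[1+j]≤n d n j<n/d = ≤-trans (*-monoʳ-≤ d j<n/d) (≤-trans (≤-reflexive (*-comm d (n / d))) (m/n*n≤m n d))

∣H∸1 : ∀ d n {c} .{{_ : NonZero d}} → (∀ {j} → d * suc j ≤ n → c ∣ Hterm d n (suc j)) → c ∣ H d n ∸ 1
∣H∸1 d n {c} c∣T = subst (c ∣_) (sym (H∸1≡∑ d n)) (∣-∑ (n / d) (c∣T ∘ <n/d⇒d*[1+j]≤n d n))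

-- Composite d ≠ 4

n∣m⇒gcd[m,n]≡n : ∀ {m n} → n ∣ m → gcd m n ≡ n
n∣m⇒gcd[m,n]≡n {m} {n} n∣m = ∣-antisym (gcd[m,n]∣n m n) (gcd-greatest n∣m ∣-refl)

n∣n! : ∀ n .{{_ : NonZero n}} → n ∣ n !
n∣n! (suc n) = m∣m*n (n !)

m<n⇒m*n∣n! : ∀ {m n} .{{_ : NonZero m}} → m < n → m * n ∣ n !
m<n⇒m*n∣n! {m} {suc n} (s≤s m≤n) = subst (_∣ suc n !) (*-comm (suc n) m)
  (*-monoʳ-∣ (suc n) (∣-trans (n∣n! m) (m≤n⇒m!∣n! m≤n)))

m≤m*n∸2 : ∀ {m n} → 2 ≤ m → 2 ≤ n → m ≤ m * n ∸ 2
m≤m*n∸2 {m@(suc (suc x))} {suc (suc y)} (s≤s (s≤s z≤n)) (s≤s (s≤s z≤n)) =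
  m+n≤o⇒m≤o∸n m (≤-trans (m≤m+n (m + 2) (x + 2 * y + x * y)) (≤-reflexive (expand x y)))
  where
  expand : ∀ x y → 2 + x + 2 + (x + 2 * y + x * y) ≡ (2 + x) * (2 + y)
  expand = solve-∀

n+n≤n*n∸2 : ∀ {n} → 3 ≤ n → n + n ≤ n * n ∸ 2
n+n≤n*n∸2 {n@(suc (suc (suc x)))} (s≤s (s≤s (s≤s z≤n))) =
  m+n≤o⇒m≤o∸n (n + n) (≤-trans (m≤m+n (n + n + 2) (1 + 4 * x + x * x)) (≤-reflexive (expand x)))
  where
  expand : ∀ x → 3 + x + (3 + x) + 2 + (1 + 4 * x + x * x) ≡ (3 + x) * (3 + x)
  expand = solve-∀

composite⇒∣[n∸2]! : ∀ {d} → Composite d → d ≢ 4 → d ∣ (d ∸ 2) !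
composite⇒∣[n∸2]! (composite {a} a<d (divides b refl)) d≢4 = factors∣ (<-cmp a b)
  where
  1<a = nonTrivial⇒n>1 a
  1<b = *-cancelʳ-< a 1 b (subst (_< b * a) (sym (*-identityˡ a)) a<d)
  instance
    _ = >-nonZero (<-trans z<s 1<a)
    _ = >-nonZero (<-trans z<s 1<b)
  factors∣ : Tri (a < b) (a ≡ b) (b < a) → b * a ∣ (b * a ∸ 2) !
  factors∣ (tri< a<b _ _) = subst (_∣ (b * a ∸ 2) !) (*-comm a b)
    (∣-trans (m<n⇒m*n∣n! a<b) (m≤n⇒m!∣n! (m≤m*n∸2 1<b 1<a)))
  factors∣ (tri> _ _ b<a) = ∣-trans (m<n⇒m*n∣n! b<a)
    (m≤n⇒m!∣n! (subst (λ x → a ≤ x ∸ 2) (*-comm a b) (m≤m*n∸2 1<a 1<b)))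
  factors∣ (tri≈ _ a≡b _) = subst (λ x → x * a ∣ (x * a ∸ 2) !) a≡b
    (∣-trans (∣-trans (*-monoʳ-∣ a (∣m∣n⇒∣m+n ∣-refl ∣-refl)) (m<n⇒m*n∣n! (m<m+n a (<-trans z<s 1<a))))
      (m≤n⇒m!∣n! (n+n≤n*n∸2 2<a)))
    where
    2<a : 2 < a
    2<a = ≤∧≢⇒< 1<a (λ 2≡a → d≢4 (cong₂ _*_ (sym (trans 2≡a a≡b)) (sym 2≡a)))

^-monoˡ-∣ : ∀ {m n} k → m ∣ n → m ^ k ∣ n ^ k
^-monoˡ-∣ zero    _   = ∣-refl
^-monoˡ-∣ (suc k) m∣n = *-pres-∣ m∣n (^-monoˡ-∣ k m∣n)

[n!]^k∣[n*k]! : ∀ n k → (n !) ^ k ∣ (n * k) !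
[n!]^k∣[n*k]! n zero    = 1∣ _
[n!]^k∣[n*k]! n (suc k) = ∣-trans (*-monoʳ-∣ (n !) ([n!]^k∣[n*k]! n k))
  (subst₂ (λ x y → n ! * x ! ∣ y !) (m+n∸m≡n n (n * k)) (sym (*-suc n k)) (k![n∸k]!∣n! (m≤m+n n (n * k))))

composite⇒n∣H∸1 : ∀ {d} n .{{_ : NonZero d}} → Composite d → d ≢ 4 → n ∣ H d n ∸ 1
composite⇒n∣H∸1 {d} n c d≢4 with nonTrivial⇒n>1 d {{composite⇒nonTrivial c}}
... | 2≤d@(s≤s (s≤s {n = f} z≤n)) = ∣H∸1 d n (λ {j} dk≤n → n∣Hterm-of-∣! d n (suc j) 2≤d dk≤n (d^k∣ j))
  where
  d^k∣ : ∀ j → d ^ suc j ∣ (d * suc j ∸ 1 ∸ suc j) !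
  d^k∣ j = ∣-trans (^-monoˡ-∣ (suc j) (composite⇒∣[n∸2]! c d≢4))
    (∣-trans ([n!]^k∣[n*k]! f (suc j)) (m≤n⇒m!∣n! (m+n≤o⇒m≤o∸n (f * suc j)
      (≤-trans (≤-reflexive (+-comm (f * suc j) (suc j))) (m≤n+m (suc f * suc j) j)))))

-- Prime d: Wilson's theorem and H_p(p m) ≡ 0 (mod p)

ν-spec : ∀ q n .{{_ : NonZero q}} .{{_ : NonZero n}} → 1 < q → ∃[ r ] (n ≡ q ^ ν q n * r × ¬ q ∣ r)
ν-spec q n 1<q = νAux-spec n ≤-refl
  where
  νAux-spec : ∀ fuel {m} .{{_ : NonZero m}} → m ≤ fuel → ∃[ r ] (m ≡ q ^ νAux fuel q m * r × ¬ q ∣ r)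
  νAux-spec zero    {suc m} ()
  νAux-spec (suc f) {m}     m≤1+f with q ∣? m
  ... | no  q∤m = m , sym (*-identityˡ m) , q∤m
  ... | yes q∣m with νAux-spec f {m / q} {{>-nonZero (m≥n⇒m/n>0 (∣⇒≤ q∣m))}} (≤-pred (≤-trans (m/n<m m q 1<q) m≤1+f))
  ...   | r , m/q≡ , q∤r = r , m≡ , q∤r
    where
    m≡ : m ≡ q * q ^ νAux f q (m / q) * r
    m≡ = begin
      m                              ≡⟨ m*[n/m]≡n q∣m ⟨
      q * (m / q)                    ≡⟨ cong (q *_) m/q≡ ⟩
      q * (q ^ νAux f q (m / q) * r) ≡⟨ *-assoc q _ r ⟨
      q * q ^ νAux f q (m / q) * r   ∎

¬∣⇒coprime : ∀ {p c} → Prime p → ¬ p ∣ c → Coprime c p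
¬∣⇒coprime p-prime p∤c (i∣c , i∣p) with prime⇒irreducible p-prime i∣p
... | inj₁ i≡1 = i≡1
... | inj₂ refl = contradiction i∣c p∤c

*-%-cong : ∀ {a a′ b b′ m} .{{_ : NonZero m}} → a % m ≡ a′ % m → b % m ≡ b′ % m → (a * b) % m ≡ (a′ * b′) % m
*-%-cong {a} {a′} {b} {b′} {m} a≡a′ b≡b′ = begin
  (a * b) % m                ≡⟨ %-distribˡ-* a b m ⟩
  (a % m * (b % m)) % m      ≡⟨ cong₂ (λ x y → (x * y) % m) a≡a′ b≡b′ ⟩
  (a′ % m * (b′ % m)) % m    ≡⟨ %-distribˡ-* a′ b′ m ⟨
  (a′ * b′) % m              ∎

↓-shift-% : ∀ {s l} m j .{{_ : NonZero m}} → l ≤ s → (s + m * j) ↓ l % m ≡ s ↓ l % m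
↓-shift-% {s}     {zero}  m j _         = refl
↓-shift-% {suc s} {suc l} m j (s≤s l≤s) = *-%-cong
  (trans (cong (λ x → (suc s + x) % m) (*-comm m j)) ([m+kn]%n≡m%n (suc s) j m))
  (↓-shift-% m j l≤s)

∏< : ℕ → (ℕ → Bool) → ℕ
∏< zero    A = 1
∏< (suc N) A = (if A N then N else 1) * ∏< N A

remove : (ℕ → Bool) → ℕ → ℕ → Bool
remove A y x with x ≟ y
... | yes _ = false
... | no  _ = A x

remove-≢ : ∀ A {x y} → x ≢ y → remove A y x ≡ A x
remove-≢ A {x} {y} x≢y with x ≟ y
... | yes x≡y = contradiction x≡y x≢y
... | no  _   = refl

remove-self : ∀ A y → remove A y y ≡ false
remove-self A y with y ≟ y
... | yes _   = refl
... | no  y≢y = contradiction refl y≢y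

remove-true : ∀ A {x y} → remove A y x ≡ true → x ≢ y × A x ≡ true
remove-true A {x} {y} eq with x ≟ y
... | no x≢y = x≢y , eq

∏-cong : ∀ N {A B} → (∀ {x} → x < N → A x ≡ B x) → ∏< N A ≡ ∏< N B
∏-cong zero    _   = refl
∏-cong (suc N) A≗B = cong₂ (λ b r → (if b then N else 1) * r) (A≗B ≤-refl) (∏-cong N (A≗B ∘ m<n⇒m<1+n))

∏-remove : ∀ {N A y} → y < N → A y ≡ true → ∏< N A ≡ y * ∏< N (remove A y)
∏-remove {suc N} {A} {y} y<1+N Ay with m<1+n⇒m<n∨m≡n y<1+N
... | inj₂ refl = begin
  (if A N then N else 1) * ∏< N A                      ≡⟨ cong (λ b → (if b then N else 1) * ∏< N A) Ay ⟩
  N * ∏< N A                                           ≡⟨ cong (N *_) (∏-cong N (λ x<N → sym (remove-≢ A (<⇒≢ x<N)))) ⟩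
  N * ∏< N (remove A N)                                ≡⟨ cong (N *_) (*-identityˡ _) ⟨
  N * (1 * ∏< N (remove A N))                          ≡⟨ cong (λ b → N * ((if b then N else 1) * ∏< N (remove A N))) (remove-self A N) ⟨
  N * ((if remove A N N then N else 1) * ∏< N (remove A N)) ∎
... | inj₁ y<N = begin
  c * ∏< N A                                           ≡⟨ cong (c *_) (∏-remove y<N Ay) ⟩
  c * (y * ∏< N (remove A y))                           ≡⟨ x∙yz≈y∙xz c y _ ⟩
  y * (c * ∏< N (remove A y))                           ≡⟨ cong (λ b → y * ((if b then N else 1) * ∏< N (remove A y))) (remove-≢ A (>⇒≢ y<N)) ⟨
  y * ((if remove A y N then N else 1) * ∏< N (remove A y)) ∎
  where
  c = if A N then N else 1

n!≡n*∏<n[2≤ᵇ] : ∀ n .{{_ : NonZero n}} → n ! ≡ n * ∏< n (2 ≤ᵇ_)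
n!≡n*∏<n[2≤ᵇ] (suc n) = cong (suc n *_) (sym (∏<[2≤ᵇ]≡! n))
  where
  ∏<[2≤ᵇ]≡! : ∀ N → ∏< (suc N) (2 ≤ᵇ_) ≡ N !
  ∏<[2≤ᵇ]≡! zero          = refl
  ∏<[2≤ᵇ]≡! (suc zero)    = refl
  ∏<[2≤ᵇ]≡! (suc (suc N)) = cong (suc (suc N) *_) (∏<[2≤ᵇ]≡! (suc N))

module _ {e} (p-prime : Prime (suc e)) where

  private
    p : ℕ
    p = suc e

  1<p : 1 < p
  1<p = nonTrivial⇒n>1 p {{prime⇒nonTrivial p-prime}}

  1%p≡1 : 1 % p ≡ 1
  1%p≡1 = m<n⇒m%n≡m 1<p

  p∤1 : ¬ p ∣ 1
  p∤1 p∣1 = <-irrefl (sym (∣1⇒≡1 p∣1)) 1<p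

  %p≡1⇒≡1+q*p : ∀ {z} → z % p ≡ 1 → z ≡ 1 + z / p * p
  %p≡1⇒≡1+q*p {z} z%p≡1 = trans (m≡m%n+[m/n]*n z p) (cong (_+ z / p * p) z%p≡1)

  n<p∧p∣n⇒n≡0 : ∀ {t} → t < p → p ∣ t → t ≡ 0
  n<p∧p∣n⇒n≡0 {zero}  _   _   = refl
  n<p∧p∣n⇒n≡0 {suc t} t<p p∣t = contradiction (∣⇒≤ p∣t) (<⇒≱ t<p)

  inverse-unique-≤ : ∀ {a b c} → a ≤ b → b < p → (a * c) % p ≡ 1 → (b * c) % p ≡ 1 → a ≡ b
  inverse-unique-≤ {a} {b} {c} a≤b b<p ac≡1 bc≡1 with euclidsLemma (b ∸ a) c p-prime p∣[b∸a]*c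
    where
    p∣[b∸a]*c : p ∣ (b ∸ a) * c
    p∣[b∸a]*c = ∣m+n∣m⇒∣n (divides (b * c / p) (suc-injective (begin
      1 + (a * c / p * p + (b ∸ a) * c)   ≡⟨ +-assoc 1 (a * c / p * p) ((b ∸ a) * c) ⟨
      1 + a * c / p * p + (b ∸ a) * c     ≡⟨ cong (_+ (b ∸ a) * c) (%p≡1⇒≡1+q*p ac≡1) ⟨
      a * c + (b ∸ a) * c                 ≡⟨ *-distribʳ-+ c a (b ∸ a) ⟨
      (a + (b ∸ a)) * c                   ≡⟨ cong (_* c) (m+[n∸m]≡n a≤b) ⟩
      b * c                               ≡⟨ %p≡1⇒≡1+q*p bc≡1 ⟩
      1 + b * c / p * p                   ∎))) (n∣m*n (a * c / p))
  ... | inj₁ p∣b∸a = begin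
    a                 ≡⟨ +-identityʳ a ⟨
    a + 0             ≡⟨ cong (a +_) (n<p∧p∣n⇒n≡0 (≤-<-trans (m∸n≤m b a) b<p) p∣b∸a) ⟨
    a + (b ∸ a)       ≡⟨ m+[n∸m]≡n a≤b ⟩
    b                 ∎
  ... | inj₂ p∣c = contradiction
    (∣m+n∣m⇒∣n (subst (p ∣_) (trans (%p≡1⇒≡1+q*p ac≡1) (+-comm 1 _)) (∣n⇒∣m*n a p∣c)) (n∣m*n (a * c / p))) p∤1

  inverse-unique : ∀ {a b c} → a < p → b < p → (a * c) % p ≡ 1 → (b * c) % p ≡ 1 → a ≡ b
  inverse-unique {a} {b} a<p b<p ac≡1 bc≡1 with ≤-total a b
  ... | inj₁ a≤b = inverse-unique-≤ a≤b b<p ac≡1 bc≡1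
  ... | inj₂ b≤a = sym (inverse-unique-≤ b≤a a<p bc≡1 ac≡1)

  inverse-exists : ∀ {x} → 0 < x → x < p → ∃[ y ] (y < p × (x * y) % p ≡ 1)
  inverse-exists {x} 0<x x<p with coprime-Bézout (prime⇒coprime p-prime {{>-nonZero 0<x}} x<p)
  ... | Bézout.-+ a b 1+a*p≡b*x = b % p , m%n<n b p , (begin
    (x * (b % p)) % p       ≡⟨ *-%-cong {x} {x} {b % p} {b} refl (m%n%n≡m%n b p) ⟩
    (x * b) % p             ≡⟨ cong (_% p) (trans (*-comm x b) (sym 1+a*p≡b*x)) ⟩
    (1 + a * p) % p         ≡⟨ [m+kn]%n≡m%n 1 a p ⟩
    1 % p                   ≡⟨ 1%p≡1 ⟩
    1                       ∎)
  ... | Bézout.+- a b 1+b*x≡a*p = e * b % p , m%n<n (e * b) p , (begin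
    (x * (e * b % p)) % p   ≡⟨ *-%-cong {x} {x} {e * b % p} {e * b} refl (m%n%n≡m%n (e * b) p) ⟩
    (x * (e * b)) % p       ≡⟨ [m+n]%n≡m%n (x * (e * b)) p ⟨
    (x * (e * b) + p) % p   ≡⟨ cong (_% p) x*[e*b]+p≡ ⟩
    (1 + e * a * p) % p     ≡⟨ [m+kn]%n≡m%n 1 (e * a) p ⟩
    1 % p                   ≡⟨ 1%p≡1 ⟩
    1                       ∎)
    where
    -- e ≡ -1 modulo p, so e * b inverts x when b * x ≡ -1
    expand : ∀ x e b → x * (e * b) + suc e ≡ 1 + e * (1 + b * x)
    expand = solve-∀
    x*[e*b]+p≡ : x * (e * b) + p ≡ 1 + e * a * p
    x*[e*b]+p≡ = begin
      x * (e * b) + p       ≡⟨ expand x e b ⟩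
      1 + e * (1 + b * x)   ≡⟨ cong (λ y → 1 + e * y) 1+b*x≡a*p ⟩
      1 + e * (a * p)       ≡⟨ cong suc (*-assoc e a p) ⟨
      1 + e * a * p         ∎

  square≢1 : ∀ {x} → 2 ≤ x → suc x < p → (x * x) % p ≢ 1
  square≢1 {suc x} (s≤s 1≤x) 2+x<p xx≡1 with euclidsLemma x (2 + x) p-prime p∣x*[2+x]
    where
    expand : ∀ x → suc x * suc x ≡ 1 + x * (2 + x)
    expand = solve-∀
    p∣x*[2+x] : p ∣ x * (2 + x)
    p∣x*[2+x] = divides (suc x * suc x / p) (suc-injective (trans (sym (expand x)) (%p≡1⇒≡1+q*p xx≡1)))
  ... | inj₁ p∣x   = <⇒≢ 1≤x (sym (n<p∧p∣n⇒n≡0 (<-trans (n<1+n x) (<-trans (n<1+n (suc x)) 2+x<p)) p∣x))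
  ... | inj₂ p∣2+x = 0≢1+n (sym (n<p∧p∣n⇒n≡0 2+x<p p∣2+x))

  InverseClosed : (ℕ → Bool) → ℕ → Set
  InverseClosed A N = ∀ {x} → x < N → A x ≡ true → ∃[ y ] (y < N × A y ≡ true × (x * y) % p ≡ 1 × y ≢ x)

  inverseClosed-drop : ∀ {A N} → A N ≡ false → InverseClosed A (suc N) → InverseClosed A N
  inverseClosed-drop {A} {N} AN≡false closed x<N Ax with closed (m<n⇒m<1+n x<N) Ax
  ... | y , y<1+N , Ay , xy≡1 , y≢x = y , ≤∧≢⇒< (≤-pred y<1+N) y≢N , Ay , xy≡1 , y≢x
    where
    y≢N : y ≢ N
    y≢N refl with trans (sym Ay) AN≡false
    ... | ()

  inverseClosed-remove : ∀ {A N y} → N < p → y < N → (N * y) % p ≡ 1 →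
                         InverseClosed A (suc N) → InverseClosed (remove A y) N
  inverseClosed-remove {A} {N} {y} N<p y<N Ny≡1 closed {x} x<N Ax with remove-true A Ax
  ... | x≢y , Ax′ with closed (m<n⇒m<1+n x<N) Ax′
  ... | z , z<1+N , Az , xz≡1 , z≢x = z , z<N , trans (remove-≢ A z≢y) Az , xz≡1 , z≢x
    where
    z≢N : z ≢ N
    z≢N refl = x≢y (inverse-unique (<-trans x<N N<p) (<-trans y<N N<p) xz≡1 (trans (cong (_% p) (*-comm y N)) Ny≡1))
    z<N = ≤∧≢⇒< (≤-pred z<1+N) z≢N
    z≢y : z ≢ y
    z≢y refl = <-irrefl (inverse-unique (<-trans x<N N<p) N<p xz≡1 Ny≡1) x<N

  -- Remove the largest element together with its inverse and recurse.
  ∏<-inverseClosed : ∀ N A → N ≤ p → InverseClosed A N → ∏< N A % p ≡ 1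
  ∏<-inverseClosed zero    A _     _      = 1%p≡1
  ∏<-inverseClosed (suc N) A 1+N≤p closed with A N in AN≡
  ... | false = trans (cong (_% p) (*-identityˡ (∏< N A)))
                      (∏<-inverseClosed N A (<⇒≤ 1+N≤p) (inverseClosed-drop AN≡ closed))
  ... | true with closed ≤-refl AN≡
  ... | y , y<1+N , Ay , Ny≡1 , y≢N = begin
    (N * ∏< N A) % p                       ≡⟨ cong (λ P → (N * P) % p) (∏-remove y<N Ay) ⟩
    (N * (y * ∏< N (remove A y))) % p      ≡⟨ cong (_% p) (*-assoc N y _) ⟨
    (N * y * ∏< N (remove A y)) % p        ≡⟨ *-%-cong {N * y} {1} {∏< N (remove A y)} {1} (trans Ny≡1 (sym 1%p≡1)) (trans rest≡1 (sym 1%p≡1)) ⟩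
    (1 * 1) % p                            ≡⟨ 1%p≡1 ⟩
    1                                      ∎
    where
    y<N = ≤∧≢⇒< (≤-pred y<1+N) y≢N
    rest≡1 = ∏<-inverseClosed N (remove A y) (<⇒≤ 1+N≤p) (inverseClosed-remove 1+N≤p y<N Ny≡1 closed)

  e*e%p≡1 : (e * e) % p ≡ 1
  e*e%p≡1 = begin
    (e * e) % p            ≡⟨ [m+n]%n≡m%n (e * e) p ⟨
    (e * e + p) % p        ≡⟨ cong (_% p) (expand e) ⟩
    (1 + e * p) % p        ≡⟨ [m+kn]%n≡m%n 1 e p ⟩
    1 % p                  ≡⟨ 1%p≡1 ⟩
    1                      ∎
    where
    expand : ∀ e → e * e + suc e ≡ 1 + e * suc e
    expand = solve-∀

  -- (2 ≤ᵇ_) below e is the set {2, …, p - 2}.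
  inverseClosed-2≤ᵇ : InverseClosed (2 ≤ᵇ_) e
  inverseClosed-2≤ᵇ {x} x<e 2≤ᵇx = partner (inverse-exists (<-trans z<s 2≤x) x<p)
    where
    2≤x = ≤ᵇ⇒≤ 2 x (subst T (sym 2≤ᵇx) _)
    x<p = <-trans x<e (n<1+n e)
    2≤ : ∀ {y} → y ≢ 0 → y ≢ 1 → 2 ≤ y
    2≤ {zero}        y≢0 _   = contradiction refl y≢0
    2≤ {suc zero}    _   y≢1 = contradiction refl y≢1
    2≤ {suc (suc _)} _   _   = s≤s (s≤s z≤n)
    partner : ∃[ y ] (y < p × (x * y) % p ≡ 1) → ∃[ y ] (y < e × (2 ≤ᵇ y) ≡ true × (x * y) % p ≡ 1 × y ≢ x)
    partner (y , y<p , xy≡1) = y , ≤∧≢⇒< (≤-pred y<p) y≢e , Equivalence.to T-≡ (≤⇒≤ᵇ (2≤ y≢0 y≢1)) , xy≡1 , y≢x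
      where
      y≢0 : y ≢ 0
      y≢0 refl = 0≢1+n (trans (sym (cong (_% p) (*-zeroʳ x))) xy≡1)
      y≢1 : y ≢ 1
      y≢1 refl = <⇒≢ 2≤x (sym (trans (sym (m<n⇒m%n≡m x<p)) (trans (cong (_% p) (sym (*-identityʳ x))) xy≡1)))
      y≢e : y ≢ e
      y≢e refl = <-irrefl (inverse-unique x<p (n<1+n e) xy≡1 e*e%p≡1) x<e
      y≢x : y ≢ x
      y≢x refl = square≢1 2≤x (s≤s x<e) xy≡1

  wilson : e ! % p ≡ e % p
  wilson = begin
    e ! % p                     ≡⟨ cong (_% p) (n!≡n*∏<n[2≤ᵇ] e {{>-nonZero (≤-pred 1<p)}}) ⟩
    (e * ∏< e (2 ≤ᵇ_)) % p      ≡⟨ *-%-cong {e} {e} {∏< e (2 ≤ᵇ_)} {1} refl (trans (∏<-inverseClosed e (2 ≤ᵇ_) (n≤1+n e) inverseClosed-2≤ᵇ) (sym 1%p≡1)) ⟩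
    (e * 1) % p                 ≡⟨ cong (_% p) (*-identityʳ e) ⟩
    e % p                       ∎

  [p*j+e]↓e≡e : ∀ j → (p * j + e) ↓ e % p ≡ e % p
  [p*j+e]↓e≡e j = begin
    (p * j + e) ↓ e % p    ≡⟨ cong (λ s → s ↓ e % p) (+-comm (p * j) e) ⟩
    (e + p * j) ↓ e % p    ≡⟨ ↓-shift-% {e} p j ≤-refl ⟩
    e ↓ e % p              ≡⟨ cong (_% p) e↓e≡e! ⟨
    e ! % p                ≡⟨ wilson ⟩
    e % p                  ∎
    where
    e↓e≡e! : e ! ≡ e ↓ e
    e↓e≡e! = trans (!≡↓*! (≤-refl {e})) (trans (cong (λ x → e ↓ e * x !) (n∸n≡0 e)) (*-identityʳ (e ↓ e)))

  -- Grouping the factors of (p m)(p m - 1)⋯ in blocks of p, each block is p (m - i) times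
  -- a product of p - 1 consecutive non-multiples of p, which is ≡ (p - 1)! ≡ e by Wilson.
  [p*m]↓[p*k]≡ : ∀ m k → ∃[ w ] ((p * m) ↓ (p * k) ≡ p ^ k * m ↓ k * w × w % p ≡ e ^ k % p)
  [p*m]↓[p*k]≡ m zero = 1 , cong ((p * m) ↓_) (*-zeroʳ p) , refl
  [p*m]↓[p*k]≡ zero (suc k) = e ^ suc k ,
    trans (cong (_↓ (p * suc k)) (*-zeroʳ p)) (sym (cong (_* e ^ suc k) (*-zeroʳ (p ^ suc k)))) , refl
  [p*m]↓[p*k]≡ (suc m) (suc k) with [p*m]↓[p*k]≡ m k
  ... | w , [pm]↓[pk]≡ , w≡ = (p * m + e) ↓ e * w , (begin
    (p * suc m) ↓ (p * suc k)                          ≡⟨ cong₂ _↓_ p*[1+m]≡ (*-suc p k) ⟩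
    (p * m + p) ↓ (p + p * k)                          ≡⟨ ↓-+ (p * m + p) p (p * k) ⟩
    (p * m + p) ↓ p * (p * m + p ∸ p) ↓ (p * k)        ≡⟨ cong₂ (λ x y → (p * m + p) * x ↓ e * y ↓ (p * k)) (+-∸-assoc (p * m) (s≤s z≤n)) (m+n∸n≡m (p * m) p) ⟩
    (p * m + p) * (p * m + e) ↓ e * (p * m) ↓ (p * k)  ≡⟨ cong ((p * m + p) * (p * m + e) ↓ e *_) [pm]↓[pk]≡ ⟩
    (p * m + p) * (p * m + e) ↓ e * (p ^ k * m ↓ k * w) ≡⟨ regroup e m ((p * m + e) ↓ e) (p ^ k) (m ↓ k) w ⟩
    p * p ^ k * (suc m * m ↓ k) * ((p * m + e) ↓ e * w) ∎) ,
    *-%-cong {(p * m + e) ↓ e} {e} {w} {e ^ k} ([p*j+e]↓e≡e m) w≡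
    where
    p*[1+m]≡ : p * suc m ≡ p * m + p
    p*[1+m]≡ = trans (*-suc p m) (+-comm p (p * m))
    regroup : ∀ e m x q f w → (suc e * m + suc e) * x * (q * f * w) ≡ suc e * q * (suc m * f) * (x * w)
    regroup = solve-∀

  Hterm[p*m]≡ : ∀ {m k} → k ≤ m → Hterm p (p * m) k % p ≡ ((m C k) * e ^ k) % p
  Hterm[p*m]≡ {m} {k} k≤m with [p*m]↓[p*k]≡ m k
  ... | w , [pm]↓[pk]≡ , w≡ = begin
    Hterm p (p * m) k % p      ≡⟨ cong (_% p) Hterm≡ ⟩
    ((m C k) * w) % p          ≡⟨ *-%-cong {m C k} {m C k} {w} {e ^ k} refl w≡ ⟩
    ((m C k) * e ^ k) % p      ∎
    where
    regroup : ∀ q c f w → q * (c * f) * w ≡ f * q * (c * w)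
    regroup = solve-∀
    Hterm≡ : Hterm p (p * m) k ≡ (m C k) * w
    Hterm≡ = *-cancelˡ-≡ _ _ (k ! * p ^ k) {{m*n≢0 (k !) (p ^ k) {{k !≢0}} {{m^n≢0 p k}}}} (begin
      k ! * p ^ k * Hterm p (p * m) k   ≡⟨ k!*d^k*Hterm≡↓ p (p * m) k (*-monoʳ-≤ p k≤m) ⟩
      (p * m) ↓ (p * k)                 ≡⟨ [pm]↓[pk]≡ ⟩
      p ^ k * m ↓ k * w                 ≡⟨ cong (λ x → p ^ k * x * w) (↓≡C*! m k) ⟩
      p ^ k * ((m C k) * k !) * w       ≡⟨ regroup (p ^ k) (m C k) (k !) w ⟩
      k ! * p ^ k * ((m C k) * w)       ∎)

  p∣H[p*m] : ∀ m .{{_ : NonZero m}} → p ∣ H p (p * m)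
  p∣H[p*m] m@(suc m-1) = m%n≡0⇒n∣m _ p (begin
    H p n % p                                   ≡⟨ cong (_% p) (H≡∑ p n) ⟩
    ∑< (suc (n / p)) (Hterm p n) % p            ≡⟨ cong (λ N → ∑< (suc N) (Hterm p n) % p) n/p≡m ⟩
    ∑< (suc m) (Hterm p n) % p                  ≡⟨ ∑-%-cong (suc m) {f = Hterm p n} {g = λ k → (m C k) * e ^ k} (Hterm[p*m]≡ ∘ ≤-pred) ⟩
    (∑[ k < suc m ] ((m C k) * e ^ k)) % p      ≡⟨ cong (_% p) (binomial-theorem e m) ⟩
    (e + 1) ^ m % p                             ≡⟨ cong (λ x → x ^ m % p) (+-comm e 1) ⟩
    (p * p ^ m-1) % p                           ≡⟨ cong (_% p) (*-comm p (p ^ m-1)) ⟩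
    (p ^ m-1 * p) % p                           ≡⟨ m*n%n≡0 (p ^ m-1) p ⟩
    0                                           ∎)
    where
    n = p * m
    n/p≡m : n / p ≡ m
    n/p≡m = trans (cong (_/ p) (*-comm p m)) (m*n/n≡m m p)

  p∣n⇒p∤H∸1 : ∀ n .{{_ : NonZero n}} → p ∣ n → ¬ p ∣ H p n ∸ 1
  p∣n⇒p∤H∸1 n (divides zero n≡0) _ = ≢-nonZero⁻¹ n n≡0
  p∣n⇒p∤H∸1 n (divides m@(suc _) n≡m*p) p∣H∸1 = p∤1 (∣m+n∣m⇒∣n p∣[H∸1]+1 p∣H∸1)
    where
    H≡[H∸1]+1 : H p n ≡ (H p n ∸ 1) + 1
    H≡[H∸1]+1 = trans (H≡1+∑ p n) (trans (+-comm 1 _) (cong (_+ 1) (sym (H∸1≡∑ p n))))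
    p∣[H∸1]+1 : p ∣ (H p n ∸ 1) + 1
    p∣[H∸1]+1 = subst (p ∣_) H≡[H∸1]+1 (subst (λ x → p ∣ H p x) (sym (trans n≡m*p (*-comm m p))) (p∣H[p*m] m))

prime⇒gcd[H∸1,n]≡n/p^ν : ∀ p n .{{_ : NonZero p}} .{{_ : NonZero n}} → Prime p →
  gcd (H p n ∸ 1) n ≡ _/_ n (p ^ ν p n) {{m^n≢0 p (ν p n)}}
prime⇒gcd[H∸1,n]≡n/p^ν p@(suc e) n p-prime with ν-spec p n (1<p p-prime)
... | r , n≡p^v*r , p∤r = begin
  g                                       ≡⟨ ∣-antisym g∣r r∣g ⟩
  r                                       ≡⟨ m*n/n≡m r (p ^ v) {{m^n≢0 p v}} ⟨
  _/_ (r * p ^ v) (p ^ v) {{m^n≢0 p v}}   ≡⟨ /-congˡ {{m^n≢0 p v}} (trans (*-comm r (p ^ v)) (sym n≡p^v*r)) ⟩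
  _/_ n (p ^ v) {{m^n≢0 p v}}             ∎
  where
  v = ν p n
  g = gcd (H p n ∸ 1) n
  r∣H∸1 : r ∣ H p n ∸ 1
  r∣H∸1 = ∣H∸1 p n (λ {j} dk≤n → ∣Hterm-of-coprime p n (suc j) (1<p p-prime) dk≤n (divides (p ^ v) n≡p^v*r) (¬∣⇒coprime p-prime p∤r))
  r∣g : r ∣ g
  r∣g = gcd-greatest r∣H∸1 (divides (p ^ v) n≡p^v*r)
  p∤g : ¬ p ∣ g
  p∤g p∣g = p∣n⇒p∤H∸1 p-prime n (∣-trans p∣g (gcd[m,n]∣n (H p n ∸ 1) n)) (∣-trans p∣g (gcd[m,n]∣m (H p n ∸ 1) n))
  g∣r : g ∣ r
  g∣r = coprime-divisor (coprime-^ v (¬∣⇒coprime p-prime p∤g)) (subst (g ∣_) n≡p^v*r (gcd[m,n]∣n (H p n ∸ 1) n))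

-- d = 4

16*n!∣[n+6]! : ∀ x → 16 * x ! ∣ (x + 6) !
16*n!∣[n+6]! x = divides (((x + 6) C 6) * 45) (begin
  (x + 6) !                             ≡⟨ !≡↓*! (m≤n+m 6 x) ⟩
  (x + 6) ↓ 6 * (x + 6 ∸ 6) !           ≡⟨ cong₂ (λ a b → a * b !) (↓≡C*! (x + 6) 6) (m+n∸n≡m x 6) ⟩
  ((x + 6) C 6) * 720 * x !             ≡⟨ regroup ((x + 6) C 6) (x !) ⟩
  ((x + 6) C 6) * 45 * (16 * x !)       ∎)
  where
  regroup : ∀ c f → c * 720 * f ≡ c * 45 * (16 * f)
  regroup = solve-∀

4^[3+j]∣[8+3j]! : ∀ j → 4 ^ (3 + j) ∣ (8 + 3 * j) !
4^[3+j]∣[8+3j]! zero          = divides 630 refl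
4^[3+j]∣[8+3j]! (suc zero)    = divides 155925 refl
4^[3+j]∣[8+3j]! (suc (suc j)) = subst₂ _∣_ (*-assoc 4 4 (4 ^ (3 + j))) (cong _! (shift j))
  (∣-trans (*-monoʳ-∣ 16 (4^[3+j]∣[8+3j]! j)) (16*n!∣[n+6]! (8 + 3 * j)))
  where
  shift : ∀ j → 8 + 3 * j + 6 ≡ 8 + 3 * (2 + j)
  shift = solve-∀

n∣Hterm₄[3+j] : ∀ n j → 4 * (3 + j) ≤ n → n ∣ Hterm 4 n (3 + j)
n∣Hterm₄[3+j] n j le = n∣Hterm-of-∣! 4 n (3 + j) (s≤s (s≤s z≤n)) le
  (subst (λ x → 4 ^ (3 + j) ∣ x !) (sym [4k∸1]∸k≡) (4^[3+j]∣[8+3j]! j))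
  where
  split : ∀ j → 2 + (j + 3 * (3 + j)) ≡ (3 + j) + (8 + 3 * j)
  split = solve-∀
  [4k∸1]∸k≡ : 4 * (3 + j) ∸ 1 ∸ (3 + j) ≡ 8 + 3 * j
  [4k∸1]∸k≡ = trans (cong (_∸ (3 + j)) (split j)) (m+n∸m≡n (3 + j) (8 + 3 * j))

-- 32 (T₁ + T₂) / n as a function of n - 1, where Tₖ = Hterm 4 n k
firstTerms₄ : ℕ → ℕ
firstTerms₄ m = m ↓ 3 * (8 + (m ∸ 3) ↓ 4)

firstTerms₄≡ : ∀ m → 8 * m ↓ 3 + m ↓ 7 ≡ firstTerms₄ m
firstTerms₄≡ m = begin
  8 * m ↓ 3 + m ↓ 7                 ≡⟨ cong (8 * m ↓ 3 +_) (↓-+ m 3 4) ⟩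
  8 * m ↓ 3 + m ↓ 3 * (m ∸ 3) ↓ 4   ≡⟨ cong (_+ m ↓ 3 * (m ∸ 3) ↓ 4) (*-comm 8 (m ↓ 3)) ⟩
  m ↓ 3 * 8 + m ↓ 3 * (m ∸ 3) ↓ 4   ≡⟨ *-distribˡ-+ (m ↓ 3) 8 ((m ∸ 3) ↓ 4) ⟨
  m ↓ 3 * (8 + (m ∸ 3) ↓ 4)         ∎

n<d*[1+n/d] : ∀ n d .{{_ : NonZero d}} → n < d * suc (n / d)
n<d*[1+n/d] n d = subst₂ _<_ (sym (m≡m%n+[m/n]*n n d))
  (trans (cong (d +_) (*-comm (n / d) d)) (sym (*-suc d (n / d))))
  (+-monoˡ-< (n / d * d) (m%n<n n d))

32*Hterm₄[1]≡ : ∀ n → 4 ≤ n → 32 * Hterm 4 n 1 ≡ n * (8 * (n ∸ 1) ↓ 3)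
32*Hterm₄[1]≡ n 4≤n = begin
  32 * Hterm 4 n 1            ≡⟨ *-assoc 8 4 (Hterm 4 n 1) ⟩
  8 * (4 * Hterm 4 n 1)       ≡⟨ cong (8 *_) (k!*d^k*Hterm≡↓ 4 n 1 4≤n) ⟩
  8 * (n * (n ∸ 1) ↓ 3)       ≡⟨ x∙yz≈y∙xz 8 n ((n ∸ 1) ↓ 3) ⟩
  n * (8 * (n ∸ 1) ↓ 3)       ∎

32*Hterm₄[2]≡ : ∀ n → 8 ≤ n → 32 * Hterm 4 n 2 ≡ n * (n ∸ 1) ↓ 7
32*Hterm₄[2]≡ n = k!*d^k*Hterm≡↓ 4 n 2

n≤1+k⇒[n∸1]↓[1+k]≡0 : ∀ {n k} → n ≤ suc k → (n ∸ 1) ↓ suc k ≡ 0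
n≤1+k⇒[n∸1]↓[1+k]≡0 n≤1+k = n<k⇒n↓k≡0 (s≤s (∸-monoˡ-≤ 1 n≤1+k))

-- All terms beyond the second are multiples of n.
32*[H₄∸1]≡ : ∀ n → ∃[ q ] (32 * (H 4 n ∸ 1) ≡ n * (firstTerms₄ (n ∸ 1) + 32 * q))
32*[H₄∸1]≡ n = map₂ (λ {q} eq → trans eq (cong (λ x → n * (x + 32 * q)) (firstTerms₄≡ (n ∸ 1))))
  (byQuotient (n / 4) refl)
  where
  X₃ = (n ∸ 1) ↓ 3
  X₇ = (n ∸ 1) ↓ 7
  n<4*[1+N] : ∀ {N} → n / 4 ≡ N → n < 4 * suc N
  n<4*[1+N] refl = n<d*[1+n/d] n 4
  sum≡ : ∀ {N} → n / 4 ≡ N → 32 * (H 4 n ∸ 1) ≡ 32 * ∑[ j < N ] Hterm 4 n (suc j)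
  sum≡ refl = cong (32 *_) (H∸1≡∑ 4 n)
  byQuotient : ∀ N → n / 4 ≡ N → ∃[ q ] (32 * (H 4 n ∸ 1) ≡ n * (8 * X₃ + X₇ + 32 * q))
  byQuotient zero n/4≡0 = 0 , (begin
    32 * (H 4 n ∸ 1)              ≡⟨ sum≡ n/4≡0 ⟩
    0                             ≡⟨ *-zeroʳ n ⟨
    n * 0                         ≡⟨ cong₂ (λ a b → n * (8 * a + b + 32 * 0)) (n≤1+k⇒[n∸1]↓[1+k]≡0 n≤3) (n≤1+k⇒[n∸1]↓[1+k]≡0 (≤-trans n≤3 (m≤m+n 3 4))) ⟨
    n * (8 * X₃ + X₇ + 32 * 0)    ∎)
    where
    n≤3 = ≤-pred (n<4*[1+N] n/4≡0)
  byQuotient (suc zero) n/4≡1 = 0 , (begin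
    32 * (H 4 n ∸ 1)              ≡⟨ sum≡ n/4≡1 ⟩
    32 * (Hterm 4 n 1 + 0)        ≡⟨ cong (32 *_) (+-identityʳ (Hterm 4 n 1)) ⟩
    32 * Hterm 4 n 1              ≡⟨ 32*Hterm₄[1]≡ n (<n/d⇒d*[1+j]≤n 4 n (subst (0 <_) (sym n/4≡1) z<s)) ⟩
    n * (8 * X₃)                  ≡⟨ cong (n *_) (trans (+-identityʳ _) (+-identityʳ _)) ⟨
    n * (8 * X₃ + 0 + 32 * 0)     ≡⟨ cong (λ b → n * (8 * X₃ + b + 32 * 0)) (n≤1+k⇒[n∸1]↓[1+k]≡0 (≤-pred (n<4*[1+N] n/4≡1))) ⟨
    n * (8 * X₃ + X₇ + 32 * 0)    ∎)
  byQuotient (suc (suc M)) n/4≡2+M = withRest (∣-∑ M (λ {j} j<M → n∣Hterm₄[3+j] n j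
                                     (<n/d⇒d*[1+j]≤n 4 n (subst (2 + j <_) (sym n/4≡2+M) (s≤s (s≤s j<M))))))
    where
    R = ∑[ j < M ] Hterm 4 n (3 + j)
    8≤n = <n/d⇒d*[1+j]≤n 4 n (subst (1 <_) (sym n/4≡2+M) (s≤s (s≤s z≤n)))
    distrib : ∀ a b c → 32 * (a + (b + c)) ≡ 32 * a + 32 * b + 32 * c
    distrib = solve-∀
    collect : ∀ n a b q → n * a + n * b + 32 * (q * n) ≡ n * (a + b + 32 * q)
    collect = solve-∀
    withRest : n ∣ R → ∃[ q ] (32 * (H 4 n ∸ 1) ≡ n * (8 * X₃ + X₇ + 32 * q))
    withRest (divides q R≡q*n) = q , (begin
      32 * (H 4 n ∸ 1)                                ≡⟨ sum≡ n/4≡2+M ⟩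
      32 * (Hterm 4 n 1 + (Hterm 4 n 2 + R))          ≡⟨ distrib (Hterm 4 n 1) (Hterm 4 n 2) R ⟩
      32 * Hterm 4 n 1 + 32 * Hterm 4 n 2 + 32 * R    ≡⟨ cong₂ _+_ (cong₂ _+_ (32*Hterm₄[1]≡ n (≤-trans (m≤m+n 4 4) 8≤n)) (32*Hterm₄[2]≡ n 8≤n))
                                                                   (cong (32 *_) R≡q*n) ⟩
      n * (8 * X₃) + n * X₇ + 32 * (q * n)            ≡⟨ collect n (8 * X₃) X₇ q ⟩
      n * (8 * X₃ + X₇ + 32 * q)                      ∎)

firstTerms₄[1+4s] : ∀ s → ∃[ w ] (firstTerms₄ (1 + 4 * s) ≡ 32 * w)
firstTerms₄[1+4s] zero          = 0 , refl
firstTerms₄[1+4s] (suc zero)    = 15 , refl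
firstTerms₄[1+4s] (suc (suc t)) = subst (λ m → ∃[ w ] (firstTerms₄ m ≡ 32 * w)) (shift t)
  (a * (1 + b) , trans (cong₂ (λ x y → x * (8 + y)) (X₃≡ t) (X₄≡ t)) (regroup a b))
  where
  a = (9 + 4 * t) * (2 + t) * (7 + 4 * t)
  b = (3 + 2 * t) * (5 + 4 * t) * (1 + t) * (3 + 4 * t)
  shift : ∀ t → 9 + 4 * t ≡ 1 + 4 * (2 + t)
  shift = solve-∀
  X₃≡ : ∀ t → (9 + 4 * t) * ((8 + 4 * t) * ((7 + 4 * t) * 1)) ≡ 4 * ((9 + 4 * t) * (2 + t) * (7 + 4 * t))
  X₃≡ = solve-∀
  X₄≡ : ∀ t → (6 + 4 * t) * ((5 + 4 * t) * ((4 + 4 * t) * ((3 + 4 * t) * 1)))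
              ≡ 8 * ((3 + 2 * t) * (5 + 4 * t) * (1 + t) * (3 + 4 * t))
  X₄≡ = solve-∀
  regroup : ∀ a b → 4 * a * (8 + 8 * b) ≡ 32 * (a * (1 + b))
  regroup = solve-∀

firstTerms₄[3+8s] : ∀ s → ∃[ w ] (firstTerms₄ (3 + 8 * s) ≡ 16 * (1 + 2 * w))
firstTerms₄[3+8s] zero    = 1 , refl
firstTerms₄[3+8s] (suc t) = subst (λ m → ∃[ w ] (firstTerms₄ m ≡ 16 * (1 + 2 * w))) (shift t)
  (c + b + 2 * c * b , trans (cong₂ (λ x y → x * (8 + y)) (X₃≡ t) (X₄≡ t)) (regroup c b))
  where
  c = 247 + 598 * t + 480 * (t * t) + 128 * (t * t * t)
  b = (1 + t) * (7 + 8 * t) * (3 + 4 * t) * (5 + 8 * t)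
  shift : ∀ t → 11 + 8 * t ≡ 3 + 8 * suc t
  shift = solve-∀
  X₃≡ : ∀ t → (11 + 8 * t) * ((10 + 8 * t) * ((9 + 8 * t) * 1))
              ≡ 2 * (1 + 2 * (247 + 598 * t + 480 * (t * t) + 128 * (t * t * t)))
  X₃≡ = solve-∀
  X₄≡ : ∀ t → (8 + 8 * t) * ((7 + 8 * t) * ((6 + 8 * t) * ((5 + 8 * t) * 1)))
              ≡ 16 * ((1 + t) * (7 + 8 * t) * (3 + 4 * t) * (5 + 8 * t))
  X₄≡ = solve-∀
  regroup : ∀ c b → 2 * (1 + 2 * c) * (8 + 16 * b) ≡ 16 * (1 + 2 * (c + b + 2 * c * b))
  regroup = solve-∀

firstTerms₄[7+8u] : ∀ u → ∃[ w ] (firstTerms₄ (7 + 8 * u) ≡ 32 * w)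
firstTerms₄[7+8u] u = a * (1 + c) , trans (cong₂ (λ x y → x * (8 + y)) (X₃≡ u) (X₄≡ u)) (regroup a c)
  where
  a = (7 + 8 * u) * (3 + 4 * u) * (5 + 8 * u)
  c = 1 + 25 * u + 140 * (u * u) + 320 * (u * u * u) + 256 * (u * u * u * u)
  X₃≡ : ∀ u → (7 + 8 * u) * ((6 + 8 * u) * ((5 + 8 * u) * 1)) ≡ 2 * ((7 + 8 * u) * (3 + 4 * u) * (5 + 8 * u))
  X₃≡ = solve-∀
  X₄≡ : ∀ u → (4 + 8 * u) * ((3 + 8 * u) * ((2 + 8 * u) * ((1 + 8 * u) * 1)))
              ≡ 8 * (1 + 2 * (1 + 25 * u + 140 * (u * u) + 320 * (u * u * u) + 256 * (u * u * u * u)))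
  X₄≡ = solve-∀
  regroup : ∀ a c → 2 * a * (8 + 8 * (1 + 2 * c)) ≡ 32 * (a * (1 + c))
  regroup = solve-∀

n∣H₄∸1 : ∀ n → ∃[ w ] (firstTerms₄ (n ∸ 1) ≡ 32 * w) → n ∣ H 4 n ∸ 1
n∣H₄∸1 n (w , firstTerms≡) = withQuotient (32*[H₄∸1]≡ n)
  where
  regroup : ∀ n w q → n * (32 * w + 32 * q) ≡ 32 * ((w + q) * n)
  regroup = solve-∀
  withQuotient : ∃[ q ] (32 * (H 4 n ∸ 1) ≡ n * (firstTerms₄ (n ∸ 1) + 32 * q)) → n ∣ H 4 n ∸ 1
  withQuotient (q , 32*[H∸1]≡) = divides (w + q) (*-cancelˡ-≡ _ _ 32 (begin
    32 * (H 4 n ∸ 1)                       ≡⟨ 32*[H∸1]≡ ⟩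
    n * (firstTerms₄ (n ∸ 1) + 32 * q)     ≡⟨ cong (λ x → n * (x + 32 * q)) firstTerms≡ ⟩
    n * (32 * w + 32 * q)                  ≡⟨ regroup n w q ⟩
    32 * ((w + q) * n)                     ∎))

¬2∣1+2* : ∀ x → ¬ 2 ∣ 1 + 2 * x
¬2∣1+2* x 2∣1+2x = contradiction (∣1⇒≡1 (∣m+n∣m⇒∣n (subst (2 ∣_) (+-comm 1 (2 * x)) 2∣1+2x) (m∣m*n x))) λ ()

¬2∣⇒≡1+2* : ∀ {r} → ¬ 2 ∣ r → ∃[ s ] (r ≡ 1 + 2 * s)
¬2∣⇒≡1+2* {r} 2∤r = r / 2 , trans (m≡m%n+[m/n]*n r 2) (cong₂ _+_ r%2≡1 (*-comm (r / 2) 2))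
  where
  r%2≡1 : r % 2 ≡ 1
  r%2≡1 with r % 2 | m%n<n r 2 | m%n≡0⇒n∣m r 2
  ... | zero     | _               | 2∣r = contradiction (2∣r refl) 2∤r
  ... | suc zero | _               | _   = refl
  ... | suc (suc _) | s≤s (s≤s ()) | _

gcd[H₄∸1,n]≡half : ∀ n h → n ≡ 2 * h → ∃[ w ] (firstTerms₄ (n ∸ 1) ≡ 16 * (1 + 2 * w)) → gcd (H 4 n ∸ 1) n ≡ h
gcd[H₄∸1,n]≡half n h n≡2h (w , firstTerms≡) = withQuotient (32*[H₄∸1]≡ n)
  where
  regroup : ∀ h w q → 2 * h * (16 * (1 + 2 * w) + 32 * q) ≡ 32 * (h * (1 + 2 * (w + q)))
  regroup = solve-∀
  withQuotient : ∃[ q ] (32 * (H 4 n ∸ 1) ≡ n * (firstTerms₄ (n ∸ 1) + 32 * q)) → gcd (H 4 n ∸ 1) n ≡ h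
  withQuotient (q , 32*[H∸1]≡) = begin
    gcd (H 4 n ∸ 1) n           ≡⟨ cong₂ gcd H∸1≡ (trans n≡2h (*-comm 2 h)) ⟩
    gcd (h * o) (h * 2)         ≡⟨ c*gcd[m,n]≡gcd[cm,cn] h o 2 ⟨
    h * gcd o 2                 ≡⟨ cong (h *_) (coprime⇒gcd≡1 (¬∣⇒coprime prime[2] (¬2∣1+2* (w + q)))) ⟩
    h * 1                       ≡⟨ *-identityʳ h ⟩
    h                           ∎
    where
    o = 1 + 2 * (w + q)
    H∸1≡ : H 4 n ∸ 1 ≡ h * o
    H∸1≡ = *-cancelˡ-≡ _ _ 32 (begin
      32 * (H 4 n ∸ 1)                       ≡⟨ 32*[H∸1]≡ ⟩
      n * (firstTerms₄ (n ∸ 1) + 32 * q)     ≡⟨ cong₂ (λ x y → x * (y + 32 * q)) n≡2h firstTerms≡ ⟩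
      2 * h * (16 * (1 + 2 * w) + 32 * q)    ≡⟨ regroup h w q ⟩
      32 * (h * o)                           ∎)

gcd[H₄∸1,n]-by-ν₂ : ∀ n v s → n ≡ 2 ^ v * (1 + 2 * s) →
  (v ≢ 2 → gcd (H 4 n ∸ 1) n ≡ n) × (v ≡ 2 → gcd (H 4 n ∸ 1) n ≡ n / 2)
gcd[H₄∸1,n]-by-ν₂ n zero s n≡ = (λ _ → n∣m⇒gcd[m,n]≡n n∣H∸1) , λ ()
  where
  n∣H∸1 : n ∣ H 4 n ∸ 1
  n∣H∸1 = ∣H∸1 4 n (λ {j} le → ∣Hterm-of-coprime 4 n (suc j) (s≤s (s≤s z≤n)) le ∣-refl
    (coprime-^ 2 (¬∣⇒coprime prime[2] (subst (λ m → ¬ 2 ∣ m) (sym (trans n≡ (+-identityʳ _))) (¬2∣1+2* s)))))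
gcd[H₄∸1,n]-by-ν₂ n (suc zero) s n≡ = (λ _ → n∣m⇒gcd[m,n]≡n (n∣H₄∸1 n
  (subst (λ m → ∃[ w ] (firstTerms₄ (m ∸ 1) ≡ 32 * w)) (sym (trans n≡ (expand s))) (firstTerms₄[1+4s] s)))) , λ ()
  where
  expand : ∀ s → 2 * (1 + 2 * s) ≡ 2 + 4 * s
  expand = solve-∀
gcd[H₄∸1,n]-by-ν₂ n (suc (suc zero)) s n≡ = (λ 2≢2 → contradiction refl 2≢2) , λ _ → begin
  gcd (H 4 n ∸ 1) n   ≡⟨ gcd[H₄∸1,n]≡half n (2 + 4 * s) n≡2h
                          (subst (λ m → ∃[ w ] (firstTerms₄ (m ∸ 1) ≡ 16 * (1 + 2 * w))) (sym n≡4+8s) (firstTerms₄[3+8s] s)) ⟩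
  2 + 4 * s           ≡⟨ m*n/n≡m (2 + 4 * s) 2 ⟨
  (2 + 4 * s) * 2 / 2 ≡⟨ cong (_/ 2) (trans (*-comm (2 + 4 * s) 2) (sym n≡2h)) ⟩
  n / 2               ∎
  where
  expand : ∀ s → 4 * (1 + 2 * s) ≡ 4 + 8 * s
  expand = solve-∀
  n≡4+8s = trans n≡ (expand s)
  double : ∀ s → 4 + 8 * s ≡ 2 * (2 + 4 * s)
  double = solve-∀
  n≡2h = trans n≡4+8s (double s)
gcd[H₄∸1,n]-by-ν₂ n (suc (suc (suc v))) s n≡ = (λ _ → n∣m⇒gcd[m,n]≡n (n∣H₄∸1 n
  (subst (λ m → ∃[ w ] (firstTerms₄ (m ∸ 1) ≡ 32 * w)) (sym n≡8+8u) (firstTerms₄[7+8u] u)))) , λ ()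
  where
  k = 2 ^ v * (1 + 2 * s)
  u = pred k
  regroup : ∀ x y → 2 * (2 * (2 * x)) * y ≡ 8 * (x * y)
  regroup = solve-∀
  expand : ∀ u → 8 * suc u ≡ 8 + 8 * u
  expand = solve-∀
  n≡8+8u : n ≡ 8 + 8 * u
  n≡8+8u = begin
    n                       ≡⟨ n≡ ⟩
    2 ^ (3 + v) * (1 + 2 * s) ≡⟨ regroup (2 ^ v) (1 + 2 * s) ⟩
    8 * k                   ≡⟨ cong (8 *_) (suc-pred k {{m*n≢0 (2 ^ v) (1 + 2 * s) {{m^n≢0 2 v}}}}) ⟨
    8 * suc u               ≡⟨ expand u ⟩
    8 + 8 * u               ∎

gcd[H₄∸1,n] : ∀ n .{{_ : NonZero n}} →
  (ν 2 n ≢ 2 → gcd (H 4 n ∸ 1) n ≡ n) × (ν 2 n ≡ 2 → gcd (H 4 n ∸ 1) n ≡ n / 2)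
gcd[H₄∸1,n] n = withOddPart (ν-spec 2 n (s≤s (s≤s z≤n)))
  where
  withOddPart : ∃[ r ] (n ≡ 2 ^ ν 2 n * r × ¬ 2 ∣ r) →
    (ν 2 n ≢ 2 → gcd (H 4 n ∸ 1) n ≡ n) × (ν 2 n ≡ 2 → gcd (H 4 n ∸ 1) n ≡ n / 2)
  withOddPart (r , n≡2^v*r , 2∤r) with ¬2∣⇒≡1+2* 2∤r
  ... | s , refl = gcd[H₄∸1,n]-by-ν₂ n (ν 2 n) s n≡2^v*r

mainTheorem11 : (d n : ℕ) → .{{_ : NonZero d}} → .{{_ : NonZero n}} → 2 ≤ d →
    ((Composite d × d ≢ 4 → gcd (H d n ∸ 1) n ≡ n)
    × (d ≡ 4 → ν 2 n ≢ 2 → gcd (H d n ∸ 1) n ≡ n)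
    × (d ≡ 4 → ν 2 n ≡ 2 → gcd (H d n ∸ 1) n ≡ n / 2)
    × (Prime d → gcd (H d n ∸ 1) n ≡ _/_ n (d ^ ν d n) {{m^n≢0 d (ν d n)}}))
-- The hypothesis 2 ≤ d is implied by each of Composite d, d ≡ 4 and Prime d.
mainTheorem11 d n _ =
    (λ (composite-d , d≢4) → n∣m⇒gcd[m,n]≡n (composite⇒n∣H∸1 n composite-d d≢4))
  , (λ { refl → proj₁ (gcd[H₄∸1,n] n) })
  , (λ { refl → proj₂ (gcd[H₄∸1,n] n) })
  , prime⇒gcd[H∸1,n]≡n/p^ν d n
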